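{- For any positive integer $n$, there exists an $n$-vertex directed graph $G=(V,E)$ with a source $s$, a sink $t$, and $(s,t)$-max-flow value one, such that any family $\mathcal{A}$ and any family $\mathcal{B}$ (as defined below) must contain at least $\Omega(n)$ flows.
   Context: Edges have unit capacity. $\mathcal{A}$ denotes a family of $(s,t)$-max-flows of $G$ such that for every set $F\subseteq E$ with $|F|=2$ and $\textsc{max-flow}(s,t,G)=\textsc{max-flow}(s,t,G-F)$, $\mathcal{A}$ contains an $(s,t)$-max-flow of $G-F$. $\mathcal{B}$ denotes a family of flows that contains an $(s,t)$-max-flow of $G-F$ for every set $F\subseteq E$ with $|F|=2$. Here $G-F$ is $G$ with the edges of $F$ deleted and $\textsc{max-flow}(s,t,\cdot)$ is the $(s,t)$-max-flow value. -}

module Defs where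

open import Data.Nat using (ℕ; _≤_)
open import Data.Fin using (Fin; _≟_)
open import Data.List using (List; []; map; allFin)
open import Data.Nat.ListAction using (sum)
open import Data.List.Relation.Unary.All using (All)
open import Data.List.Relation.Unary.Any using (Any)
open import Data.Bool using (if_then_else_)
open import Data.Integer using (ℤ; +_; _-_)
open import Data.Product using (Σ; _×_)
open import Relation.Nullary using (¬_; does)
open import Relation.Binary.PropositionalEquality using (_≡_; _≢_)

record Digraph (n : ℕ) : Set where
  field
    m   : ℕ
    src : Fin m → Fin n
    tgt : Fin m → Fin n
open Digraph public

Simple : ∀ {n} → Digraph n → Set
Simple G = (∀ e → src G e ≢ tgt G e)
         × (∀ e e′ → src G e ≡ src G e′ → tgt G e ≡ tgt G e′ → e ≡ e′)

EdgeFun : ∀ {n} → Digraph n → Set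
EdgeFun G = Fin (m G) → ℕ

outflow : ∀ {n} (G : Digraph n) → EdgeFun G → Fin n → ℕ
outflow G f v = sum (map (λ e → if does (src G e ≟ v) then f e else 0) (allFin (m G)))

inflow : ∀ {n} (G : Digraph n) → EdgeFun G → Fin n → ℕ
inflow G f v = sum (map (λ e → if does (tgt G e ≟ v) then f e else 0) (allFin (m G)))

value : ∀ {n} (G : Digraph n) → Fin n → EdgeFun G → ℤ
value G s f = + outflow G f s - + inflow G f s

-- f is an (s,t)-flow of G - F (F a list of deleted edges), unit capacities:
-- 0 ≤ f e ≤ 1, f vanishes on deleted edges, conservation at every v ∉ {s,t}.
IsFlow : ∀ {n} (G : Digraph n) (s t : Fin n) (F : List (Fin (m G))) → EdgeFun G → Set
IsFlow G s t F f =
    (∀ e → f e ≤ 1)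
  × All (λ e → f e ≡ 0) F
  × (∀ v → v ≢ s → v ≢ t → inflow G f v ≡ outflow G f v)

IsMaxFlow : ∀ {n} (G : Digraph n) (s t : Fin n) (F : List (Fin (m G))) → EdgeFun G → Set
IsMaxFlow G s t F f =
  IsFlow G s t F f × (∀ g → IsFlow G s t F g → value G s g Data.Integer.≤ value G s f)

MaxFlowValue : ∀ {n} (G : Digraph n) (s t : Fin n) (F : List (Fin (m G))) → ℤ → Set
MaxFlowValue G s t F v = Σ (EdgeFun G) λ f → IsMaxFlow G s t F f × value G s f ≡ v

SameMaxFlow : ∀ {n} (G : Digraph n) (s t : Fin n) (F : List (Fin (m G))) → Set
SameMaxFlow G s t F = Σ ℤ λ v → MaxFlowValue G s t [] v × MaxFlowValue G s t F v

pair : ∀ {k} → Fin k → Fin k → List (Fin k)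
pair e₁ e₂ = e₁ Data.List.∷ e₂ Data.List.∷ []

Distinct : ∀ {n} {G : Digraph n} {k} → (Fin k → EdgeFun G) → Set
Distinct {G = G} {k} 𝒜 = ∀ i j → (∀ e → 𝒜 i e ≡ 𝒜 j e) → i ≡ j

FamilyA : ∀ {n} (G : Digraph n) (s t : Fin n) {k} → (Fin k → EdgeFun G) → Set
FamilyA G s t {k} 𝒜 =
    (∀ i → IsMaxFlow G s t [] (𝒜 i))
  × (∀ e₁ e₂ → e₁ ≢ e₂ → SameMaxFlow G s t (pair e₁ e₂) →
       Σ (Fin k) λ i → IsMaxFlow G s t (pair e₁ e₂) (𝒜 i))

FamilyB : ∀ {n} (G : Digraph n) (s t : Fin n) {k} → (Fin k → EdgeFun G) → Set
FamilyB G s t {k} ℬ =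
    (∀ i → IsFlow G s t [] (ℬ i))
  × (∀ e₁ e₂ → e₁ ≢ e₂ → Σ (Fin k) λ i → IsMaxFlow G s t (pair e₁ e₂) (ℬ i))

module Submission where

-- The graph is a ladder: a top row and a bottom row, both directed left to right, joined by downward
-- rungs, with s at the left end of the top row and t at the right end of the bottom row. Every s-t path
-- uses exactly one rung, and the first top edge alone is a cut, so the max-flow value is 1. For p < r
-- let F_p consist of top edge p+1 and bottom edge p; in G - F_p the only s-t path is the one through
-- rung p, so F_p does not lower the max-flow. For p < q, top edge p+1 and bottom edge q together form
-- a cut, so no flow of value 1 avoids both: a single flow cannot be a max-flow of both G - F_p and
-- G - F_q. Hence both kinds of families need at least r flows, and the ladder on n vertices has r ≥ n/7.

open import Defs
open import Data.Nat using (ℕ; zero; suc; _+_; _*_; _≤_; _<_; z≤n; s≤s; _≤?_; _<?_) renaming (_≟_ to _≟ℕ_)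
open import Data.Nat.Properties
  using (≤-refl; ≤-reflexive; ≤-trans; ≤-<-trans; ≤-antisym; ≤-pred; n≤1+n; <⇒≤; <⇒≢; >⇒≢; <⇒≱; ≤⇒≯; <-asym; <-irrefl; 1+n≰n; m<n⇒m<1+n; ≰⇒>; <-cmp;
         +-comm; +-assoc; +-mono-≤; +-cancelˡ-≤; m≤m+n; m≤n+m; m+n∸n≡m; *-monoʳ-≤; *-suc; +-commutativeSemigroup)
open import Algebra.Properties.CommutativeSemigroup +-commutativeSemigroup using () renaming (interchange to +-interchange)
open import Data.Fin using (Fin; toℕ; fromℕ<; _≟_) renaming (zero to fzero; suc to fsuc)
open import Data.Fin.Properties using (toℕ<n; toℕ-fromℕ<; toℕ-injective; suc-injective; injective⇒≤)
open import Data.List using (List; []; map; allFin; tabulate)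
open import Data.List.Properties using (map-tabulate)
open import Data.List.Relation.Unary.All using (All; []; _∷_)
open import Data.Nat.ListAction using (sum)
open import Data.Bool using (Bool; true; false; if_then_else_; _∧_; not)
open import Data.Integer as ℤ using (+_)
import Data.Integer.Properties as ℤ
open import Data.Product using (Σ; _×_; _,_; proj₁; proj₂)
open import Data.Sum using (_⊎_; inj₁; inj₂; swap)
open import Data.Empty using (⊥; ⊥-elim)
open import Relation.Nullary using (¬_; does; yes; no; Dec)
open import Relation.Nullary.Decidable using (dec-true; dec-false)
open import Relation.Binary using (tri<; tri≈; tri>)
open import Relation.Binary.PropositionalEquality
  using (_≡_; _≢_; refl; sym; trans; cong; cong₂; subst; subst₂; module ≡-Reasoning)
open import Function using (_∘_; id)

∑ : ∀ {m} → (Fin m → ℕ) → ℕ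
∑ {zero}  h = 0
∑ {suc m} h = h fzero + ∑ (h ∘ fsuc)

sum-map-allFin : ∀ {m} (h : Fin m → ℕ) → sum (map h (allFin m)) ≡ ∑ h
sum-map-allFin {m} h = trans (cong sum (map-tabulate id h)) (sum-tabulate h)
  where
  sum-tabulate : ∀ {k} (g : Fin k → ℕ) → sum (tabulate g) ≡ ∑ g
  sum-tabulate {zero}  g = refl
  sum-tabulate {suc k} g = cong (_+_ (g fzero)) (sum-tabulate (g ∘ fsuc))

∑-cong : ∀ {m} {h g : Fin m → ℕ} → (∀ e → h e ≡ g e) → ∑ h ≡ ∑ g
∑-cong {zero}  p = refl
∑-cong {suc m} p = cong₂ _+_ (p fzero) (∑-cong (p ∘ fsuc))

∑-zero : ∀ {m} (h : Fin m → ℕ) → (∀ e → h e ≡ 0) → ∑ h ≡ 0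
∑-zero {zero}  h z = refl
∑-zero {suc m} h z = cong₂ _+_ (z fzero) (∑-zero (h ∘ fsuc) (z ∘ fsuc))

∑-single : ∀ {m} (h : Fin m → ℕ) (e₀ : Fin m) → (∀ e → e ≢ e₀ → h e ≡ 0) → ∑ h ≡ h e₀
∑-single h fzero z =
  trans (cong (_+_ (h fzero)) (∑-zero (h ∘ fsuc) λ e → z (fsuc e) λ ())) (+-comm (h fzero) 0)
∑-single h (fsuc e₀) z =
  cong₂ _+_ (z fzero λ ()) (∑-single (h ∘ fsuc) e₀ λ e e≢e₀ → z (fsuc e) (e≢e₀ ∘ suc-injective))

∑-mono-≤ : ∀ {m} {h g : Fin m → ℕ} → (∀ e → h e ≤ g e) → ∑ h ≤ ∑ g
∑-mono-≤ {zero}  p = z≤n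
∑-mono-≤ {suc m} p = +-mono-≤ (p fzero) (∑-mono-≤ (p ∘ fsuc))

∑-distrib-+ : ∀ {m} (h g : Fin m → ℕ) → ∑ (λ e → h e + g e) ≡ ∑ h + ∑ g
∑-distrib-+ {zero}  h g = refl
∑-distrib-+ {suc m} h g = begin
  (h₀ + g₀) + ∑ (λ e → h (fsuc e) + g (fsuc e)) ≡⟨ cong (_+_ (h₀ + g₀)) (∑-distrib-+ (h ∘ fsuc) (g ∘ fsuc)) ⟩
  (h₀ + g₀) + (H + K)                           ≡⟨ +-interchange h₀ g₀ H K ⟩
  (h₀ + H) + (g₀ + K)                           ∎
  where
  open ≡-Reasoning
  h₀ g₀ H K : ℕ
  h₀ = h fzero
  g₀ = g fzero
  H = ∑ (h ∘ fsuc)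
  K = ∑ (g ∘ fsuc)

∑-swap : ∀ {m k} (h : Fin m → Fin k → ℕ) → ∑ (λ i → ∑ (h i)) ≡ ∑ (λ j → ∑ (λ i → h i j))
∑-swap {zero}  {k} h = sym (∑-zero {k} (λ _ → 0) (λ _ → refl))
∑-swap {suc m} {k} h = begin
  ∑ (h fzero) + ∑ (λ i → ∑ (h (fsuc i)))            ≡⟨ cong (_+_ (∑ (h fzero))) (∑-swap (h ∘ fsuc)) ⟩
  ∑ (h fzero) + ∑ (λ j → ∑ (λ i → h (fsuc i) j))    ≡⟨ ∑-distrib-+ (h fzero) _ ⟨
  ∑ (λ j → h fzero j + ∑ (λ i → h (fsuc i) j))      ∎
  where open ≡-Reasoning

∑-by-endpoint : ∀ {m n} (end : Fin m → Fin n) (S : Fin n → Bool) (f : Fin m → ℕ) →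
  ∑ (λ v → if S v then ∑ (λ e → if does (end e ≟ v) then f e else 0) else 0)
  ≡ ∑ (λ e → if S (end e) then f e else 0)
∑-by-endpoint {m} {n} end S f =
  trans (∑-cong λ v → if-∑ (S v) (at v)) (trans (∑-swap {n} {m} λ v e → if S v then at v e else 0) (∑-cong at-end))
  where
  at : Fin n → Fin m → ℕ
  at v e = if does (end e ≟ v) then f e else 0
  if-∑ : ∀ b (h : Fin m → ℕ) → (if b then ∑ h else 0) ≡ ∑ (λ e → if b then h e else 0)
  if-∑ true  h = refl
  if-∑ false h = sym (∑-zero {m} _ λ _ → refl)
  at-end : ∀ e → ∑ (λ v → if S v then at v e else 0) ≡ (if S (end e) then f e else 0)
  at-end e = trans (∑-single _ (end e) off) on
    where
    off : ∀ v → v ≢ end e → (if S v then at v e else 0) ≡ 0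
    off v v≢ rewrite dec-false (end e ≟ v) (v≢ ∘ sym) with S v
    ... | true  = refl
    ... | false = refl
    on : (if S (end e) then at (end e) e else 0) ≡ (if S (end e) then f e else 0)
    on rewrite dec-true (end e ≟ end e) refl = refl

∑-at : ∀ {m} (w : Fin m) x → ∑ (λ v → if does (v ≟ w) then x else 0) ≡ x
∑-at w x = trans (∑-single _ w off) (cong (λ b → if b then x else 0) (dec-true (w ≟ w) refl))
  where
  off : ∀ v → v ≢ w → (if does (v ≟ w) then x else 0) ≡ 0
  off v v≢w rewrite dec-false (v ≟ w) v≢w = refl

m≤n+o⇒m-o≤n : ∀ {m n o} → m ≤ n + o → + m ℤ.- + o ℤ.≤ + n
m≤n+o⇒m-o≤n {m} {n} {o} m≤n+o = ℤ.≤-trans (ℤ.≤-reflexive (ℤ.m-n≡m⊖n m o))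
  (ℤ.≤-trans (ℤ.⊖-monoˡ-≤ o m≤n+o)
    (ℤ.≤-reflexive (trans (ℤ.≤-⊖ (m≤n+m o n)) (cong +_ (m+n∸n≡m n o)))))

module _ {n} (G : Digraph n) (f : EdgeFun G) where

  outflow-∑ : ∀ v → outflow G f v ≡ ∑ (λ e → if does (src G e ≟ v) then f e else 0)
  outflow-∑ v = sum-map-allFin (λ e → if does (src G e ≟ v) then f e else 0)

  inflow-∑ : ∀ v → inflow G f v ≡ ∑ (λ e → if does (tgt G e ≟ v) then f e else 0)
  inflow-∑ v = sum-map-allFin (λ e → if does (tgt G e ≟ v) then f e else 0)

  crossing : (Fin n → Bool) → ℕ
  crossing S = ∑ λ e → if S (src G e) ∧ not (S (tgt G e)) then f e else 0

  -- Summing conservation over the vertices of S cancels every edge inside S.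
  value≤crossing : (s t : Fin n) (S : Fin n → Bool) → S s ≡ true → S t ≡ false →
    (∀ v → v ≢ s → v ≢ t → inflow G f v ≡ outflow G f v) →
    value G s f ℤ.≤ + crossing S
  value≤crossing s t S Ss St conservation =
    subst₂ (λ o i → + o ℤ.- + i ℤ.≤ + crossing S) (sym (outflow-∑ s)) (sym (inflow-∑ s))
      (m≤n+o⇒m-o≤n (+-cancelˡ-≤ B (O s) (crossing S + I s) B+Os≤B+C+Is))
    where
    open ≡-Reasoning
    O I : Fin n → ℕ
    O v = ∑ (λ e → if does (src G e ≟ v) then f e else 0)
    I v = ∑ (λ e → if does (tgt G e ≟ v) then f e else 0)
    A B : ℕ
    A = ∑ (λ e → if S (src G e) then f e else 0)
    B = ∑ (λ e → if S (tgt G e) then f e else 0)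

    on-S : (Fin n → ℕ) → Fin n → ℕ
    on-S h v = if S v then h v else 0
    at-s : ℕ → Fin n → ℕ
    at-s x v = if does (v ≟ s) then x else 0

    balanced : ∀ v → on-S O v + at-s (I s) v ≡ on-S I v + at-s (O s) v
    balanced v with v ≟ s
    ... | yes refl rewrite Ss = +-comm (O s) (I s)
    ... | no v≢s with S v in Sv
    ...   | false = refl
    ...   | true  = cong (_+ 0) (trans (sym (outflow-∑ v)) (trans (sym (conservation v v≢s v≢t)) (inflow-∑ v)))
      where
      v≢t : v ≢ t
      v≢t refl with trans (sym Sv) St
      ... | ()

    A+Is≡B+Os : A + I s ≡ B + O s
    A+Is≡B+Os = begin
      A + I s                                    ≡⟨ cong₂ _+_ (∑-by-endpoint (src G) S f) (∑-at s (I s)) ⟨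
      ∑ (on-S O) + ∑ (at-s (I s))                ≡⟨ ∑-distrib-+ (on-S O) (at-s (I s)) ⟨
      ∑ (λ v → on-S O v + at-s (I s) v)          ≡⟨ ∑-cong balanced ⟩
      ∑ (λ v → on-S I v + at-s (O s) v)          ≡⟨ ∑-distrib-+ (on-S I) (at-s (O s)) ⟩
      ∑ (on-S I) + ∑ (at-s (O s))                ≡⟨ cong₂ _+_ (∑-by-endpoint (tgt G) S f) (∑-at s (O s)) ⟩
      B + O s                                    ∎

    A≤B+C : A ≤ B + crossing S
    A≤B+C = ≤-trans (∑-mono-≤ edgewise) (≤-reflexive (∑-distrib-+ (λ e → if S (tgt G e) then f e else 0) _))
      where
      edgewise : ∀ e → (if S (src G e) then f e else 0)
                     ≤ (if S (tgt G e) then f e else 0) + (if S (src G e) ∧ not (S (tgt G e)) then f e else 0)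
      edgewise e with S (src G e) | S (tgt G e)
      ... | true  | true  = m≤m+n (f e) 0
      ... | true  | false = ≤-refl
      ... | false | _     = z≤n

    B+Os≤B+C+Is : B + O s ≤ B + (crossing S + I s)
    B+Os≤B+C+Is = subst₂ _≤_ A+Is≡B+Os (+-assoc B (crossing S) (I s)) (+-mono-≤ A≤B+C ≤-refl)

data Row : Set where
  top bottom : Row

data Kind : Set where
  along-top rung along-bottom : Kind

Position Label : Set
Position = ℕ × Row
Label    = ℕ × Kind

-- Ladder vertex (i , row) is digraph vertex 2i or 2i+1, and edge (j , kind) is digraph edge 3j, 3j+1 or 3j+2.
encodePosition : Position → ℕ
encodePosition (zero  , top)    = 0
encodePosition (zero  , bottom) = 1
encodePosition (suc i , row)    = 2 + encodePosition (i , row)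

decodePosition : ℕ → Position
decodePosition 0               = 0 , top
decodePosition 1               = 0 , bottom
decodePosition (suc (suc c)) with decodePosition c
... | i , row = suc i , row

encode-decodePosition : ∀ c → encodePosition (decodePosition c) ≡ c
encode-decodePosition 0 = refl
encode-decodePosition 1 = refl
encode-decodePosition (suc (suc c)) with decodePosition c | encode-decodePosition c
... | i , row | eq = cong (suc ∘ suc) eq

decode-encodePosition : ∀ x → decodePosition (encodePosition x) ≡ x
decode-encodePosition (zero  , top)    = refl
decode-encodePosition (zero  , bottom) = refl
decode-encodePosition (suc i , row) rewrite decode-encodePosition (i , row) = refl

encodePosition-mono : ∀ {i k} row → i ≤ k → encodePosition (i , row) ≤ encodePosition (k , bottom)
encodePosition-mono top    z≤n           = z≤n
encodePosition-mono bottom (z≤n {zero})  = ≤-refl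
encodePosition-mono bottom (z≤n {suc k}) = ≤-trans (encodePosition-mono bottom (z≤n {k})) (m≤n+m _ 2)
encodePosition-mono row    (s≤s i≤k)     = s≤s (s≤s (encodePosition-mono row i≤k))

encodeLabel : Label → ℕ
encodeLabel (zero  , along-top)    = 0
encodeLabel (zero  , rung)         = 1
encodeLabel (zero  , along-bottom) = 2
encodeLabel (suc j , kind)         = 3 + encodeLabel (j , kind)

decodeLabel : ℕ → Label
decodeLabel 0 = 0 , along-top
decodeLabel 1 = 0 , rung
decodeLabel 2 = 0 , along-bottom
decodeLabel (suc (suc (suc c))) with decodeLabel c
... | j , kind = suc j , kind

encode-decodeLabel : ∀ c → encodeLabel (decodeLabel c) ≡ c
encode-decodeLabel 0 = refl
encode-decodeLabel 1 = refl
encode-decodeLabel 2 = refl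
encode-decodeLabel (suc (suc (suc c))) with decodeLabel c | encode-decodeLabel c
... | j , kind | eq = cong (suc ∘ suc ∘ suc) eq

decode-encodeLabel : ∀ y → decodeLabel (encodeLabel y) ≡ y
decode-encodeLabel (zero  , along-top)    = refl
decode-encodeLabel (zero  , rung)         = refl
decode-encodeLabel (zero  , along-bottom) = refl
decode-encodeLabel (suc j , kind) rewrite decode-encodeLabel (j , kind) = refl

encodeLabel-mono : ∀ {j k} kind → j ≤ k → encodeLabel (j , kind) ≤ encodeLabel (k , along-bottom)
encodeLabel-mono kind         (s≤s j≤k)     = s≤s (s≤s (s≤s (encodeLabel-mono kind j≤k)))
encodeLabel-mono along-top    z≤n           = z≤n
encodeLabel-mono rung         (z≤n {zero})  = s≤s z≤n
encodeLabel-mono rung         (z≤n {suc k}) = ≤-trans (encodeLabel-mono rung (z≤n {k})) (m≤n+m _ 3)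
encodeLabel-mono along-bottom (z≤n {zero})  = ≤-refl
encodeLabel-mono along-bottom (z≤n {suc k}) = ≤-trans (encodeLabel-mono along-bottom (z≤n {k})) (m≤n+m _ 3)

encodeLabel-≤⇒≤ : ∀ {j k} kind → encodeLabel (j , kind) ≤ encodeLabel (k , along-bottom) → j ≤ k
encodeLabel-≤⇒≤ {zero}  kind _ = z≤n
encodeLabel-≤⇒≤ {suc j} {zero} along-top    (s≤s (s≤s ()))
encodeLabel-≤⇒≤ {suc j} {zero} rung         (s≤s (s≤s ()))
encodeLabel-≤⇒≤ {suc j} {zero} along-bottom (s≤s (s≤s ()))
encodeLabel-≤⇒≤ {suc j} {suc k} kind (s≤s (s≤s (s≤s le))) = s≤s (encodeLabel-≤⇒≤ kind le)

-- s = (0 , top) and t = (r+1 , bottom). The edge (0 , along-bottom) leaves a vertex without in-edges, so it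
-- carries no flow; it is there only so that every label (j , kind) with j ≤ r is an edge.
tail head : Label → Position
tail (j , along-top)    = j , top
tail (j , rung)         = suc j , top
tail (j , along-bottom) = j , bottom
head (j , along-top)    = suc j , top
head (j , rung)         = suc j , bottom
head (j , along-bottom) = suc j , bottom

tail≢head : ∀ y → tail y ≢ head y
tail≢head (j , along-top)    ()
tail≢head (j , rung)         ()
tail≢head (j , along-bottom) ()

tail-head-injective : ∀ y y′ → tail y ≡ tail y′ → head y ≡ head y′ → y ≡ y′
tail-head-injective (j , along-top)    (j′ , along-top)    refl _    = refl
tail-head-injective (j , rung)         (j′ , rung)         refl _    = refl
tail-head-injective (j , along-bottom) (j′ , along-bottom) refl _    = refl
tail-head-injective (j , along-top)    (j′ , rung)         _    ()
tail-head-injective (j , along-top)    (j′ , along-bottom) ()   _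
tail-head-injective (j , rung)         (j′ , along-top)    _    ()
tail-head-injective (j , rung)         (j′ , along-bottom) ()   _
tail-head-injective (j , along-bottom) (j′ , along-top)    ()   _
tail-head-injective (j , along-bottom) (j′ , rung)         ()   _

tail-≤ : ∀ {r} y → proj₁ y ≤ r → proj₁ (tail y) ≤ suc r
tail-≤ (j , along-top)    j≤r = ≤-trans j≤r (n≤1+n _)
tail-≤ (j , rung)         j≤r = s≤s j≤r
tail-≤ (j , along-bottom) j≤r = ≤-trans j≤r (n≤1+n _)

head-≤ : ∀ {r} y → proj₁ y ≤ r → proj₁ (head y) ≤ suc r
head-≤ (j , along-top)    j≤r = s≤s j≤r
head-≤ (j , rung)         j≤r = s≤s j≤r
head-≤ (j , along-bottom) j≤r = s≤s j≤r

nothing-enters-column-0 : ∀ y {row} → head y ≢ (0 , row)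
nothing-enters-column-0 (j , along-top)    ()
nothing-enters-column-0 (j , rung)         ()
nothing-enters-column-0 (j , along-bottom) ()

into-top : ∀ {i} y → head y ≡ (suc i , top) → y ≡ (i , along-top)
into-top (j , along-top)    refl = refl
into-top (j , rung)         ()
into-top (j , along-bottom) ()

into-bottom : ∀ {i} y → head y ≡ (suc i , bottom) → y ≡ (i , rung) ⊎ y ≡ (i , along-bottom)
into-bottom (j , along-top)    ()
into-bottom (j , rung)         refl = inj₁ refl
into-bottom (j , along-bottom) refl = inj₂ refl

out-of-origin : ∀ y → tail y ≡ (0 , top) → y ≡ (0 , along-top)
out-of-origin (j , along-top)    refl = refl
out-of-origin (j , rung)         ()
out-of-origin (j , along-bottom) ()

out-of-top : ∀ {i} y → tail y ≡ (suc i , top) → y ≡ (suc i , along-top) ⊎ y ≡ (i , rung)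
out-of-top (j , along-top)    refl = inj₁ refl
out-of-top (j , rung)         refl = inj₂ refl
out-of-top (j , along-bottom) ()

out-of-bottom : ∀ {i} y → tail y ≡ (i , bottom) → y ≡ (i , along-bottom)
out-of-bottom (j , along-top)    ()
out-of-bottom (j , rung)         ()
out-of-bottom (j , along-bottom) refl = refl

one-vanishes : ∀ {A : Set} (g : A → ℕ) {y y₀} → y ≡ y₀ → g y₀ ≡ 0 → g y ≡ 0
one-vanishes _ refl g₀≡0 = g₀≡0

both-vanish : ∀ {A : Set} (g : A → ℕ) {y y₀ y₁} → y ≡ y₀ ⊎ y ≡ y₁ → g y₀ ≡ 0 → g y₁ ≡ 0 → g y ≡ 0
both-vanish _ (inj₁ refl) g₀≡0 _    = g₀≡0
both-vanish _ (inj₂ refl) _    g₁≡0 = g₁≡0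

other-vanishes : ∀ {A : Set} (g : A → ℕ) {y y₀ y₁} → y ≡ y₀ ⊎ y ≡ y₁ → y ≢ y₀ → g y₁ ≡ 0 → g y ≡ 0
other-vanishes _ (inj₁ y≡y₀) y≢y₀ _    = ⊥-elim (y≢y₀ y≡y₀)
other-vanishes _ (inj₂ refl) _    g₁≡0 = g₁≡0

region : ℕ → ℕ → Position → Bool
region α β (i , top)    = does (i ≤? suc α)
region α β (i , bottom) = does (i ≤? β)

does-true : ∀ {A : Set} (a? : Dec A) → does a? ≡ true → A
does-true (yes a) _ = a

does-false : ∀ {A : Set} (a? : Dec A) → does a? ≡ false → ¬ A
does-false (no ¬a) _ = ¬a

∧-not : ∀ a b → a ∧ not b ≡ true → a ≡ true × b ≡ false
∧-not true false refl = refl , refl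

leaves-region : ∀ {α β} → α < β → ∀ y → region α β (tail y) ∧ not (region α β (head y)) ≡ true →
  y ≡ (suc α , along-top) ⊎ y ≡ (β , along-bottom)
leaves-region {α} {β} α<β (j , along-top) leaves
  with tail-in , head-out ← ∧-not (does (j ≤? suc α)) (does (suc j ≤? suc α)) leaves
  = inj₁ (cong (_, along-top)
      (≤-antisym (does-true (j ≤? suc α) tail-in) (≤-pred (≰⇒> (does-false (suc j ≤? suc α) head-out)))))
leaves-region {α} {β} α<β (j , rung) leaves
  with tail-in , head-out ← ∧-not (does (suc j ≤? suc α)) (does (suc j ≤? β)) leaves
  = ⊥-elim (<⇒≱ α<β (≤-pred (≤-trans (≰⇒> (does-false (suc j ≤? β) head-out)) (does-true (suc j ≤? suc α) tail-in))))
leaves-region {α} {β} α<β (j , along-bottom) leaves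
  with tail-in , head-out ← ∧-not (does (j ≤? β)) (does (suc j ≤? β)) leaves
  = inj₂ (cong (_, along-bottom)
      (≤-antisym (does-true (j ≤? β) tail-in) (≤-pred (≰⇒> (does-false (suc j ≤? β) head-out)))))

𝟙 : ∀ {A : Set} → Dec A → ℕ
𝟙 (yes _) = 1
𝟙 (no _)  = 0

𝟙-yes : ∀ {A : Set} (a? : Dec A) → A → 𝟙 a? ≡ 1
𝟙-yes (yes _) _ = refl
𝟙-yes (no ¬a) a = ⊥-elim (¬a a)

𝟙-no : ∀ {A : Set} (a? : Dec A) → ¬ A → 𝟙 a? ≡ 0
𝟙-no (yes a) ¬a = ⊥-elim (¬a a)
𝟙-no (no _)  _  = refl

𝟙≤1 : ∀ {A : Set} (a? : Dec A) → 𝟙 a? ≤ 1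
𝟙≤1 (yes _) = ≤-refl
𝟙≤1 (no _)  = z≤n

-- Along the top row to (p+1 , top), down rung p, along the bottom row to t.
path : ℕ → Label → ℕ
path p (j , along-top)    = 𝟙 (j ≤? p)
path p (j , rung)         = 𝟙 (j ≟ℕ p)
path p (j , along-bottom) = 𝟙 (p <? j)

module Ladder (r n : ℕ) (fits : encodePosition (suc r , bottom) < n) where

  M : ℕ
  M = suc (encodeLabel (r , along-bottom))

  position : Fin n → Position
  position v = decodePosition (toℕ v)

  -- Positions beyond the ladder are sent to the junk vertex 0; they never occur.
  vertex : Position → Fin n
  vertex x with encodePosition x <? n
  ... | yes x<n = fromℕ< x<n
  ... | no _    = fromℕ< (≤-<-trans z≤n fits)

  position-vertex : ∀ {i} row → i ≤ suc r → position (vertex (i , row)) ≡ (i , row)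
  position-vertex {i} row i≤r+1 with encodePosition (i , row) <? n
  ... | yes x<n = trans (cong decodePosition (toℕ-fromℕ< x<n)) (decode-encodePosition (i , row))
  ... | no x≮n  = ⊥-elim (x≮n (≤-<-trans (encodePosition-mono row i≤r+1) fits))

  position-injective : ∀ {v w} → position v ≡ position w → v ≡ w
  position-injective {v} {w} eq = toℕ-injective (begin
    toℕ v                              ≡⟨ encode-decodePosition (toℕ v) ⟨
    encodePosition (position v)        ≡⟨ cong encodePosition eq ⟩
    encodePosition (position w)        ≡⟨ encode-decodePosition (toℕ w) ⟩
    toℕ w                              ∎)
    where open ≡-Reasoning

  label : Fin M → Label
  label e = decodeLabel (toℕ e)

  label-≤ : ∀ e → proj₁ (label e) ≤ r
  label-≤ e with label e in eq
  ... | j , kind = encodeLabel-≤⇒≤ kind (≤-pred (subst (_< M)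
        (trans (sym (encode-decodeLabel (toℕ e))) (cong encodeLabel eq)) (toℕ<n e)))

  edge : ∀ y → proj₁ y ≤ r → Fin M
  edge (j , kind) j≤r = fromℕ< (s≤s (encodeLabel-mono kind j≤r))

  label-edge : ∀ y (j≤r : proj₁ y ≤ r) → label (edge y j≤r) ≡ y
  label-edge (j , kind) j≤r = trans (cong decodeLabel (toℕ-fromℕ< _)) (decode-encodeLabel (j , kind))

  label-injective : ∀ {e e′} → label e ≡ label e′ → e ≡ e′
  label-injective {e} {e′} eq = toℕ-injective (begin
    toℕ e                              ≡⟨ encode-decodeLabel (toℕ e) ⟨
    encodeLabel (label e)              ≡⟨ cong encodeLabel eq ⟩
    encodeLabel (label e′)             ≡⟨ encode-decodeLabel (toℕ e′) ⟩
    toℕ e′                             ∎)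
    where open ≡-Reasoning

  G : Digraph n
  G = record { m = M ; src = vertex ∘ tail ∘ label ; tgt = vertex ∘ head ∘ label }

  s t : Fin n
  s = vertex (0 , top)
  t = vertex (suc r , bottom)

  position-src : ∀ e → position (src G e) ≡ tail (label e)
  position-src e with label e | label-≤ e
  ... | y | j≤r = position-vertex (proj₂ (tail y)) (tail-≤ y j≤r)

  position-tgt : ∀ e → position (tgt G e) ≡ head (label e)
  position-tgt e with label e | label-≤ e
  ... | y | j≤r = position-vertex (proj₂ (head y)) (head-≤ y j≤r)

  flow : (Label → ℕ) → EdgeFun G
  flow g = g ∘ label

  module Incidence (end : Label → Position) (endpoint : Fin M → Fin n)
                   (position-endpoint : ∀ e → position (endpoint e) ≡ end (label e)) where

    at : (Label → ℕ) → Fin n → ℕ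
    at g v = ∑ λ e → if does (endpoint e ≟ v) then g (label e) else 0

    at-none : ∀ g {v x} → position v ≡ x → (∀ y → proj₁ y ≤ r → end y ≡ x → g y ≡ 0) → at g v ≡ 0
    at-none g {v} pv none = ∑-zero _ vanishes
      where
      vanishes : ∀ e → (if does (endpoint e ≟ v) then g (label e) else 0) ≡ 0
      vanishes e with endpoint e ≟ v
      ... | yes refl = none (label e) (label-≤ e) (trans (sym (position-endpoint e)) pv)
      ... | no _     = refl

    at-one : ∀ g {v x} y₀ (j₀≤r : proj₁ y₀ ≤ r) → position v ≡ x → end y₀ ≡ x →
      (∀ y → proj₁ y ≤ r → end y ≡ x → y ≢ y₀ → g y ≡ 0) → at g v ≡ g y₀
    at-one g {v} y₀ j₀≤r pv y₀-at-x others = trans (∑-single _ e₀ vanishes) at-e₀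
      where
      e₀ : Fin M
      e₀ = edge y₀ j₀≤r
      vanishes : ∀ e → e ≢ e₀ → (if does (endpoint e ≟ v) then g (label e) else 0) ≡ 0
      vanishes e e≢e₀ with endpoint e ≟ v
      ... | yes refl = others (label e) (label-≤ e) (trans (sym (position-endpoint e)) pv)
                         λ eq → e≢e₀ (label-injective (trans eq (sym (label-edge y₀ j₀≤r))))
      ... | no _     = refl
      e₀-at-v : endpoint e₀ ≡ v
      e₀-at-v = position-injective
        (trans (position-endpoint e₀) (trans (cong end (label-edge y₀ j₀≤r)) (trans y₀-at-x (sym pv))))
      at-e₀ : (if does (endpoint e₀ ≟ v) then g (label e₀) else 0) ≡ g y₀
      at-e₀ rewrite dec-true (endpoint e₀ ≟ v) e₀-at-v = cong g (label-edge y₀ j₀≤r)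

  module In  = Incidence head (tgt G) position-tgt
  module Out = Incidence tail (src G) position-src

  module _ {p} (p≤r : p ≤ r) where

    balanced : ∀ {v k} → In.at (path p) v ≡ k → Out.at (path p) v ≡ k → In.at (path p) v ≡ Out.at (path p) v
    balanced in≡k out≡k = trans in≡k (sym out≡k)

    path-conserved-top : ∀ {v} i → position v ≡ (suc i , top) → In.at (path p) v ≡ Out.at (path p) v
    path-conserved-top i pv with <-cmp i p
    ... | tri< i<p _ _ = balanced
      (trans (In.at-one (path p) (i , along-top) (≤-trans (<⇒≤ i<p) p≤r) pv refl
                λ y _ hy y≢ → ⊥-elim (y≢ (into-top y hy)))
             (𝟙-yes (i ≤? p) (<⇒≤ i<p)))
      (trans (Out.at-one (path p) (suc i , along-top) (≤-trans i<p p≤r) pv refl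
                λ y _ hy y≢ → other-vanishes (path p) (out-of-top y hy) y≢ (𝟙-no (i ≟ℕ p) (<⇒≢ i<p)))
             (𝟙-yes (suc i ≤? p) i<p))
    ... | tri≈ _ refl _ = balanced
      (trans (In.at-one (path p) (p , along-top) p≤r pv refl λ y _ hy y≢ → ⊥-elim (y≢ (into-top y hy)))
             (𝟙-yes (p ≤? p) ≤-refl))
      (trans (Out.at-one (path p) (p , rung) p≤r pv refl
                λ y _ hy y≢ → other-vanishes (path p) (swap (out-of-top y hy)) y≢ (𝟙-no (suc p ≤? p) 1+n≰n))
             (𝟙-yes (p ≟ℕ p) refl))
    ... | tri> _ _ p<i = balanced
      (In.at-none (path p) pv λ y _ hy → one-vanishes (path p) (into-top y hy) (𝟙-no (i ≤? p) (<⇒≱ p<i)))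
      (Out.at-none (path p) pv λ y _ hy →
        both-vanish (path p) (out-of-top y hy) (𝟙-no (suc i ≤? p) (<⇒≱ (m<n⇒m<1+n p<i))) (𝟙-no (i ≟ℕ p) (>⇒≢ p<i)))

    path-conserved-bottom : ∀ {v} i → i < r → position v ≡ (suc i , bottom) → In.at (path p) v ≡ Out.at (path p) v
    path-conserved-bottom i i<r pv with <-cmp i p
    ... | tri< i<p _ _ = balanced
      (In.at-none (path p) pv λ y _ hy →
        both-vanish (path p) (into-bottom y hy) (𝟙-no (i ≟ℕ p) (<⇒≢ i<p)) (𝟙-no (p <? i) (<-asym i<p)))
      (Out.at-none (path p) pv λ y _ hy → one-vanishes (path p) (out-of-bottom y hy) (𝟙-no (p <? suc i) (≤⇒≯ i<p)))
    ... | tri≈ _ refl _ = balanced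
      (trans (In.at-one (path p) (p , rung) p≤r pv refl
                λ y _ hy y≢ → other-vanishes (path p) (into-bottom y hy) y≢ (𝟙-no (p <? p) (<-irrefl refl)))
             (𝟙-yes (p ≟ℕ p) refl))
      (trans (Out.at-one (path p) (suc p , along-bottom) i<r pv refl λ y _ hy y≢ → ⊥-elim (y≢ (out-of-bottom y hy)))
             (𝟙-yes (p <? suc p) ≤-refl))
    ... | tri> _ _ p<i = balanced
      (trans (In.at-one (path p) (i , along-bottom) (<⇒≤ i<r) pv refl
                λ y _ hy y≢ → other-vanishes (path p) (swap (into-bottom y hy)) y≢ (𝟙-no (i ≟ℕ p) (>⇒≢ p<i)))
             (𝟙-yes (p <? i) p<i))
      (trans (Out.at-one (path p) (suc i , along-bottom) i<r pv refl λ y _ hy y≢ → ⊥-elim (y≢ (out-of-bottom y hy)))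
             (𝟙-yes (p <? suc i) (m<n⇒m<1+n p<i)))

    path-conserved : ∀ v → v ≢ s → v ≢ t → inflow G (flow (path p)) v ≡ outflow G (flow (path p)) v
    path-conserved v v≢s v≢t =
      trans (inflow-∑ G _ v) (trans (conserved-at (position v) refl) (sym (outflow-∑ G _ v)))
      where
      conserved-at : ∀ x → position v ≡ x → In.at (path p) v ≡ Out.at (path p) v
      conserved-at (zero , top) pv = ⊥-elim (v≢s (position-injective (trans pv (sym (position-vertex top z≤n)))))
      conserved-at (zero , bottom) pv = balanced
        (In.at-none (path p) pv λ y _ hy → ⊥-elim (nothing-enters-column-0 y hy))
        (Out.at-none (path p) pv λ y _ hy → one-vanishes (path p) (out-of-bottom y hy) (𝟙-no (p <? 0) λ ()))
      conserved-at (suc i , top) pv = path-conserved-top i pv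
      conserved-at (suc i , bottom) pv with <-cmp i r
      ... | tri< i<r _ _ = path-conserved-bottom i i<r pv
      ... | tri≈ _ refl _ = ⊥-elim (v≢t (position-injective (trans pv (sym (position-vertex bottom ≤-refl)))))
      ... | tri> _ _ r<i = balanced (In.at-none (path p) pv no-in) (Out.at-none (path p) pv no-out)
        where
        no-in : ∀ y → proj₁ y ≤ r → head y ≡ (suc i , bottom) → path p y ≡ 0
        no-in y j≤r hy with into-bottom y hy
        ... | inj₁ refl = ⊥-elim (<⇒≱ r<i j≤r)
        ... | inj₂ refl = ⊥-elim (<⇒≱ r<i j≤r)
        no-out : ∀ y → proj₁ y ≤ r → tail y ≡ (suc i , bottom) → path p y ≡ 0
        no-out y j≤r hy with out-of-bottom y hy
        ... | refl = ⊥-elim (<⇒≱ (m<n⇒m<1+n r<i) j≤r)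

    path-isFlow : ∀ F → All (λ e → flow (path p) e ≡ 0) F → IsFlow G s t F (flow (path p))
    path-isFlow F avoids = (λ e → path≤1 (label e)) , avoids , path-conserved
      where
      path≤1 : ∀ y → path p y ≤ 1
      path≤1 (j , along-top)    = 𝟙≤1 (j ≤? p)
      path≤1 (j , rung)         = 𝟙≤1 (j ≟ℕ p)
      path≤1 (j , along-bottom) = 𝟙≤1 (p <? j)

    path-value : value G s (flow (path p)) ≡ + 1
    path-value = cong₂ (λ o i → + o ℤ.- + i)
      (trans (outflow-∑ G _ s) (trans (Out.at-one (path p) (0 , along-top) z≤n s-at-origin refl
        (λ y _ hy y≢ → ⊥-elim (y≢ (out-of-origin y hy)))) (𝟙-yes (0 ≤? p) z≤n)))
      (trans (inflow-∑ G _ s) (In.at-none (path p) s-at-origin λ y _ hy → ⊥-elim (nothing-enters-column-0 y hy)))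
      where
      s-at-origin : position s ≡ (0 , top)
      s-at-origin = position-vertex top z≤n

  leaving : (Position → Bool) → EdgeFun G → Fin M → ℕ
  leaving σ g e = if σ (tail (label e)) ∧ not (σ (head (label e))) then g e else 0

  value≤leaving : ∀ (σ : Position → Bool) → σ (0 , top) ≡ true → σ (suc r , bottom) ≡ false →
    ∀ g → (∀ v → v ≢ s → v ≢ t → inflow G g v ≡ outflow G g v) → value G s g ℤ.≤ + ∑ (leaving σ g)
  value≤leaving σ σ-origin σ-end g conservation =
    subst (λ c → value G s g ℤ.≤ + c) (∑-cong by-labels)
      (value≤crossing G g s t (σ ∘ position)
        (trans (cong σ (position-vertex top z≤n)) σ-origin) (trans (cong σ (position-vertex bottom ≤-refl)) σ-end)
        conservation)
    where
    by-labels : ∀ e → (if σ (position (src G e)) ∧ not (σ (position (tgt G e))) then g e else 0) ≡ leaving σ g e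
    by-labels e rewrite position-src e | position-tgt e = refl

  -- The cut around s is the single edge (0 , along-top).
  value≤1 : ∀ {F} g → IsFlow G s t F g → value G s g ℤ.≤ + 1
  value≤1 g (g≤1 , _ , conservation) =
    ℤ.≤-trans (value≤leaving origin refl refl g conservation) (ℤ.+≤+ (subst (_≤ 1) (sym only-e₀) (≤-trans (at-most (g e₀)) (g≤1 e₀))))
    where
    origin : Position → Bool
    origin (_     , bottom) = false
    origin (zero  , top)    = true
    origin (suc _ , top)    = false
    e₀ : Fin M
    e₀ = edge (0 , along-top) z≤n
    at-most : ∀ {b} x → (if b then x else 0) ≤ x
    at-most {true}  x = ≤-refl
    at-most {false} x = z≤n
    only-e₀ : ∑ (leaving origin g) ≡ leaving origin g e₀
    only-e₀ = ∑-single _ e₀ λ e e≢e₀ → not-leaving e (λ eq → e≢e₀ (label-injective (trans eq (sym (label-edge _ z≤n)))))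
      where
      not-leaving : ∀ e → label e ≢ (0 , along-top) → leaving origin g e ≡ 0
      not-leaving e ≢e₀ with label e
      ... | zero  , along-top    = ⊥-elim (≢e₀ refl)
      ... | suc j , along-top    = refl
      ... | j     , rung         = refl
      ... | j     , along-bottom = refl

  value≤0-avoiding : ∀ {α β} → α < β → β < r → ∀ g → (∀ v → v ≢ s → v ≢ t → inflow G g v ≡ outflow G g v) →
    (∀ e → label e ≡ (suc α , along-top) → g e ≡ 0) → (∀ e → label e ≡ (β , along-bottom) → g e ≡ 0) →
    value G s g ℤ.≤ + 0
  value≤0-avoiding {α} {β} α<β β<r g conservation top-blocked bottom-blocked =
    subst (λ c → value G s g ℤ.≤ + c) (∑-zero _ nothing-leaves)
      (value≤leaving (region α β) refl (dec-false (suc r ≤? β) (<⇒≱ (m<n⇒m<1+n β<r))) g conservation)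
    where
    nothing-leaves : ∀ e → leaving (region α β) g e ≡ 0
    nothing-leaves e with region α β (tail (label e)) ∧ not (region α β (head (label e))) in leaves
    ... | false = refl
    ... | true with leaves-region α<β (label e) leaves
    ...   | inj₁ at-top    = top-blocked e at-top
    ...   | inj₂ at-bottom = bottom-blocked e at-bottom

  isMaxFlow-path : ∀ {p F} → p ≤ r → All (λ e → flow (path p) e ≡ 0) F → IsMaxFlow G s t F (flow (path p))
  isMaxFlow-path {F = F} p≤r avoids =
    path-isFlow p≤r F avoids , λ g g-flow → subst (value G s g ℤ.≤_) (sym (path-value p≤r)) (value≤1 g g-flow)

  maxFlowValue : MaxFlowValue G s t [] (+ 1)
  maxFlowValue = flow (path 0) , isMaxFlow-path z≤n [] , path-value z≤n

  top-edge bottom-edge : Fin r → Fin M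
  top-edge    p = edge (suc (toℕ p) , along-top) (toℕ<n p)
  bottom-edge p = edge (toℕ p , along-bottom) (<⇒≤ (toℕ<n p))

  blocked : Fin r → List (Fin M)
  blocked p = pair (top-edge p) (bottom-edge p)

  top≢bottom : ∀ p → top-edge p ≢ bottom-edge p
  top≢bottom p eq with trans (sym (label-edge _ (toℕ<n p))) (trans (cong label eq) (label-edge _ (<⇒≤ (toℕ<n p))))
  ... | ()

  path-avoids-blocked : ∀ p → All (λ e → flow (path (toℕ p)) e ≡ 0) (blocked p)
  path-avoids-blocked p =
    trans (cong (path a) (label-edge _ (toℕ<n p))) (𝟙-no (suc a ≤? a) 1+n≰n) ∷
    trans (cong (path a) (label-edge _ (<⇒≤ (toℕ<n p)))) (𝟙-no (a <? a) (<-irrefl refl)) ∷ []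
    where
    a : ℕ
    a = toℕ p

  vanishes-at : ∀ {g : EdgeFun G} y (j≤r : proj₁ y ≤ r) → g (edge y j≤r) ≡ 0 → ∀ e → label e ≡ y → g e ≡ 0
  vanishes-at {g} y j≤r g≡0 e eq =
    subst (λ e′ → g e′ ≡ 0) (label-injective (trans (label-edge y j≤r) (sym eq))) g≡0

  -- Maximality against path p forces value 1, but for p < q the region cut of p and q consists of
  -- top-edge p and bottom-edge q, on which g vanishes.
  no-common-max-flow : ∀ {p q} → toℕ p < toℕ q → ∀ g →
    IsMaxFlow G s t (blocked p) g → IsMaxFlow G s t (blocked q) g → ⊥
  no-common-max-flow {p} {q} p<q g ((_ , top-p≡0 ∷ _ , conservation) , maximal) ((_ , _ ∷ bottom-q≡0 ∷ _ , _) , _)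
    with ℤ.≤-trans (subst (ℤ._≤ value G s g) (path-value (<⇒≤ (toℕ<n p)))
                            (maximal _ (path-isFlow (<⇒≤ (toℕ<n p)) _ (path-avoids-blocked p))))
                   (value≤0-avoiding p<q (toℕ<n q) g conservation
                     (vanishes-at _ (toℕ<n p) top-p≡0) (vanishes-at _ (<⇒≤ (toℕ<n q)) bottom-q≡0))
  ... | ℤ.+≤+ ()

  Covers : ∀ {k} → (Fin k → EdgeFun G) → Set
  Covers {k} 𝒞 = ∀ p → Σ (Fin k) λ i → IsMaxFlow G s t (blocked p) (𝒞 i)

  covers⇒r≤k : ∀ {k} (𝒞 : Fin k → EdgeFun G) → Covers 𝒞 → r ≤ k
  covers⇒r≤k {k} 𝒞 covers = injective⇒≤ injective
    where
    witness : Fin r → Fin k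
    witness p = proj₁ (covers p)
    injective : ∀ {p q} → witness p ≡ witness q → p ≡ q
    injective {p} {q} same with <-cmp (toℕ p) (toℕ q)
    ... | tri< p<q _ _ = ⊥-elim (no-common-max-flow p<q _ (proj₂ (covers p))
                                  (subst (λ i → IsMaxFlow G s t (blocked q) (𝒞 i)) (sym same) (proj₂ (covers q))))
    ... | tri≈ _ p≡q _ = toℕ-injective p≡q
    ... | tri> _ _ q<p = ⊥-elim (no-common-max-flow q<p _ (proj₂ (covers q))
                                  (subst (λ i → IsMaxFlow G s t (blocked p) (𝒞 i)) same (proj₂ (covers p))))

  familyA-covers : ∀ {k} (𝒜 : Fin k → EdgeFun G) → FamilyA G s t 𝒜 → Covers 𝒜
  familyA-covers 𝒜 (_ , contains) p = contains _ _ (top≢bottom p)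
    (+ 1 , maxFlowValue , flow (path (toℕ p)) , isMaxFlow-path p≤r (path-avoids-blocked p) , path-value p≤r)
    where
    p≤r : toℕ p ≤ r
    p≤r = <⇒≤ (toℕ<n p)

  familyB-covers : ∀ {k} (ℬ : Fin k → EdgeFun G) → FamilyB G s t ℬ → Covers ℬ
  familyB-covers ℬ (_ , contains) p = contains _ _ (top≢bottom p)

  simple : Simple G
  simple = (λ e loop → tail≢head (label e) (trans (sym (position-src e)) (trans (cong position loop) (position-tgt e))))
         , λ e e′ same-src same-tgt → label-injective (tail-head-injective (label e) (label e′)
             (trans (sym (position-src e)) (trans (cong position same-src) (position-src e′)))
             (trans (sym (position-tgt e)) (trans (cong position same-tgt) (position-tgt e′))))

  s≢t : s ≢ t
  s≢t s≡t with trans (sym (position-vertex top z≤n)) (trans (cong position s≡t) (position-vertex bottom ≤-refl))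
  ... | ()

ladder-fits : ∀ n → 6 ≤ n → Σ ℕ λ r → encodePosition (suc r , bottom) < n × n ≤ 7 * r
ladder-fits (suc (suc (suc (suc (suc (suc m)))))) (s≤s (s≤s (s≤s (s≤s (s≤s (s≤s z≤n)))))) with fit m
  where
  fit : ∀ m → Σ ℕ λ r → encodePosition (suc (suc r) , bottom) < 6 + m × 6 + m ≤ 7 * suc r
  fit 0 = 0 , ≤-refl , n≤1+n 6
  fit 1 = 0 , n≤1+n 6 , ≤-refl
  fit (suc (suc m)) with fit m
  ... | r , fits , 6+m≤7r = suc r , s≤s (s≤s fits)
      , subst (8 + m ≤_) (sym (*-suc 7 (suc r))) (+-mono-≤ {2} {7} (s≤s (s≤s z≤n)) 6+m≤7r)
... | r , fits , n≤7r = suc r , fits , n≤7r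

theorem15 : Σ ℕ λ c → Σ ℕ λ N → ∀ n → N ≤ n →
    Σ (Digraph n) λ G → Σ (Fin n) λ s → Σ (Fin n) λ t →
      s ≢ t × Simple G × MaxFlowValue G s t [] (+ 1)
      × (∀ k (𝒜 : Fin k → EdgeFun G) → Distinct {G = G} 𝒜 → FamilyA G s t 𝒜 → n ≤ c * k)
      × (∀ k (ℬ : Fin k → EdgeFun G) → Distinct {G = G} ℬ → FamilyB G s t ℬ → n ≤ c * k)
theorem15 = 7 , 6 , λ n 6≤n →
  let r , fits , n≤7r = ladder-fits n 6≤n
      open Ladder r n fits
  in G , s , t , s≢t , simple , maxFlowValue
   , (λ k 𝒜 _ 𝒜-family → ≤-trans n≤7r (*-monoʳ-≤ 7 (covers⇒r≤k 𝒜 (familyA-covers 𝒜 𝒜-family))))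
   , (λ k ℬ _ ℬ-family → ≤-trans n≤7r (*-monoʳ-≤ 7 (covers⇒r≤k ℬ (familyB-covers ℬ ℬ-family))))
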